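{- Let $k\ge 2$, $n$ and $p$ be positive integers. Every shuffle-preserved $2$-coloring of the $n\times n\times\cdots\times n$ complete $k$-partite multigraph contains a monochromatic copy of the complete $p\times p\times\cdots\times p$ $k$-partite graph if and only if $2(p-1)<n$.
   Context: The complete $n\times\cdots\times n$ $k$-partite multigraph has vertex set $S_1\cup\cdots\cup S_k$ (disjoint parts, $|S_i|=n$), edges only between vertices of different parts, possibly multiple edges (no loops), and every two vertices in different parts joined by at least one edge. A $2$-coloring assigns to each edge one of at most $2$ colors. For a color $c$, let $W_c$ be the set of vertices incident to an edge of color $c$; the coloring is shuffle-preserved if for every color $c$, any two vertices of $W_c$ lying in different parts are joined by an edge of color $c$. A monochromatic copy of the complete $p\times\cdots\times p$ $k$-partite graph consists of sets $A_i\subseteq S_i$ with $|A_i|=p$ and a color $c$ such that any two vertices in distinct $A_i,A_j$ are joined by an edge of color $c$. -}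

module Defs where

open import Data.Nat using (ℕ; _*_; _∸_; _<_)
open import Data.Fin using (Fin)
open import Data.Product using (Σ; ∃; _×_; _,_; proj₁; proj₂)
open import Data.Sum using (_⊎_)
open import Relation.Binary.PropositionalEquality using (_≡_; _≢_)
open import Function.Definitions using (Injective)

-- Vertices of the complete n×⋯×n k-partite multigraph:
-- a vertex (i , a) lies in part S_i and is the a-th vertex of that part.
Vertex : ℕ → ℕ → Set
Vertex k n = Fin k × Fin n

part : ∀ {k n} → Vertex k n → Fin k
part = proj₁

Colour : Set
Colour = Fin 2

record ColouredMultigraph (k n : ℕ) : Set where
  field
    m      : ℕ
    ends   : Fin m → Vertex k n × Vertex k n
    colour : Fin m → Colour

open ColouredMultigraph public

EdgeJoins : ∀ {k n} (G : ColouredMultigraph k n) → Fin (m G) → Vertex k n → Vertex k n → Set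
EdgeJoins G e u v = (ends G e ≡ (u , v)) ⊎ (ends G e ≡ (v , u))

JoinedBy : ∀ {k n} (G : ColouredMultigraph k n) → Colour → Vertex k n → Vertex k n → Set
JoinedBy G c u v = Σ (Fin (m G)) λ e → (colour G e ≡ c) × EdgeJoins G e u v

IsCompleteMultipartite : ∀ {k n} → ColouredMultigraph k n → Set
IsCompleteMultipartite {k} {n} G =
  ((e : Fin (m G)) → part (proj₁ (ends G e)) ≢ part (proj₂ (ends G e)))
  × ((u v : Vertex k n) → part u ≢ part v → Σ (Fin (m G)) λ e → EdgeJoins G e u v)

InW : ∀ {k n} (G : ColouredMultigraph k n) → Colour → Vertex k n → Set
InW {k} {n} G c u = Σ (Fin (m G)) λ e → (colour G e ≡ c) × Σ (Vertex k n) λ v → EdgeJoins G e u v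

ShufflePreserved : ∀ {k n} → ColouredMultigraph k n → Set
ShufflePreserved {k} {n} G =
  (c : Colour) (u v : Vertex k n) → InW G c u → InW G c v → part u ≢ part v → JoinedBy G c u v

-- monochromatic copy of the complete p×⋯×p k-partite graph:
-- sets A_i ⊆ S_i of size p (given as injections Fin p → Fin n) and a colour c
-- such that any two vertices in distinct A_i, A_j are joined by an edge of colour c.
HasMonoCopy : ∀ {k n} → ℕ → ColouredMultigraph k n → Set
HasMonoCopy {k} {n} p G =
  Σ (Fin k → Fin p → Fin n) λ A →
    ((i : Fin k) → Injective _≡_ _≡_ (A i)) ×
    Σ Colour λ c → (i j : Fin k) (a b : Fin p) → i ≢ j → JoinedBy G c (i , A i a) (j , A j b)

-- Write p = h + 1.  If 2h < n, every vertex lies in W₀ or W₁.  Either every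
-- part meets W₀ in at least p vertices, and shuffle-preservation turns any p
-- of them per part into a copy of colour 0; or some part S_i has at most h
-- vertices in W₀, hence at least n − h ≥ p outside it.  A vertex a ∉ W₀ of
-- S_i sees every other part through edges of colour 1, so all vertices of
-- the other parts, together with the vertices of S_i outside W₀, lie in W₁,
-- which yields a copy of colour 1.  If n ≤ 2h, colour the first h vertices
-- of S₁ with 0 only and the remaining n − h ≤ h with 1 only, and join all
-- other pairs in both colours: no colour class of S₁ has p vertices.
module Submission where

open import Defs
open import Data.Nat using (ℕ; _*_; _∸_; _<_; _≤_)
open import Data.Product using (_×_)

open import Data.Nat using (zero; suc; _+_; _<?_; _≤?_; s≤s; z≤n)
open import Data.Nat.Properties
  using (≤-trans; 1+n≰n; +-suc; +-identityʳ; +-mono-≤; m≤m+n; m+n∸m≡n; m∸n+n≡m; ∸-monoˡ-<; ≤-pred; ≰⇒>; ≮⇒≥; <⇒≱)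
open import Data.Fin using (Fin; toℕ; fromℕ<; inject≤)
  renaming (zero to fzero; suc to fsuc)
open import Data.Fin.Properties
  using (suc-injective; inject≤-injective; toℕ-injective; toℕ-fromℕ<; toℕ<n; injective⇒≤; all?; any?; ¬∀⟶∃¬)
  renaming (_≟_ to _≟ᶠ_)
open import Data.List using (List; length; lookup; filter; allFin; cartesianProduct)
open import Data.List.Membership.Propositional using (_∈_)
open import Data.List.Membership.Propositional.Properties
  using (∈-lookup; ∈-filter⁺; ∈-filter⁻; ∈-allFin; ∈-cartesianProduct⁺)
open import Data.List.Relation.Unary.Any using (index)
open import Data.List.Relation.Unary.Any.Properties using (lookup-index)
open import Data.Product using (Σ; _,_; proj₁; proj₂)
open import Data.Product.Properties using (≡-dec)
open import Data.Sum using (inj₁; inj₂; swap)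
open import Data.Unit using (⊤; tt)
open import Data.Empty using (⊥-elim)
open import Level using (0ℓ)
open import Relation.Nullary using (¬_; Dec; yes; no; _×-dec_; ¬?)
open import Relation.Unary using (Pred; Decidable; ∁)
open import Relation.Unary.Properties using (∁?)
open import Relation.Binary.PropositionalEquality
  using (_≡_; _≢_; refl; sym; trans; cong; subst; module ≡-Reasoning)
open import Function using (_∘_)
open import Function.Definitions using (Injective)

Pick : ∀ {n} → ℕ → Pred (Fin n) 0ℓ → Set
Pick {n} p P = Σ (Fin p → Fin n) λ f → Injective _≡_ _≡_ f × (∀ a → P (f a))

count : ∀ {n} {P : Pred (Fin n) 0ℓ} → Decidable P → ℕ
count {zero}  P? = 0
count {suc n} P? with P? fzero
... | yes _ = suc (count (P? ∘ fsuc))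
... | no _  = count (P? ∘ fsuc)

count+count-∁ : ∀ {n} {P : Pred (Fin n) 0ℓ} (P? : Decidable P) → count P? + count (∁? P?) ≡ n
count+count-∁ {zero}  P? = refl
count+count-∁ {suc n} P? with P? fzero
... | yes _ = cong suc (count+count-∁ (P? ∘ fsuc))
... | no _  = trans (+-suc _ _) (cong suc (count+count-∁ (P? ∘ fsuc)))

pick-all : ∀ {n} {P : Pred (Fin n) 0ℓ} (P? : Decidable P) → Pick (count P?) P
pick-all {zero}  P? = (λ ()) , (λ {}) , (λ ())
pick-all {suc n} {P} P? with P? fzero | pick-all {P = P ∘ fsuc} (P? ∘ fsuc)
... | yes P0 | f , f-inj , f∈P = g , g-inj , g∈P
  where
    g : Fin (suc (count (P? ∘ fsuc))) → Fin (suc n)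
    g fzero    = fzero
    g (fsuc a) = fsuc (f a)
    g-inj : Injective _≡_ _≡_ g
    g-inj {fzero}  {fzero}  _  = refl
    g-inj {fsuc a} {fsuc b} eq = cong fsuc (f-inj (suc-injective eq))
    g∈P : ∀ a → P (g a)
    g∈P fzero    = P0
    g∈P (fsuc a) = f∈P a
... | no _ | f , f-inj , f∈P = fsuc ∘ f , f-inj ∘ suc-injective , f∈P

pick-fewer : ∀ {n p q} {P : Pred (Fin n) 0ℓ} → p ≤ q → Pick q P → Pick p P
pick-fewer p≤q (f , f-inj , f∈P) =
  f ∘ (λ a → inject≤ a p≤q) , (λ eq → inject≤-injective p≤q p≤q _ _ (f-inj eq)) , (λ a → f∈P _)

pick : ∀ {n p} {P : Pred (Fin n) 0ℓ} (P? : Decidable P) → p ≤ count P? → Pick p P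
pick {P = P} P? p≤count = pick-fewer {P = P} p≤count (pick-all P?)

pick-map : ∀ {n p} {P Q : Pred (Fin n) 0ℓ} → (∀ {a} → P a → Q a) → Pick p P → Pick p Q
pick-map P⇒Q (f , f-inj , f∈P) = f , f-inj , P⇒Q ∘ f∈P

pick-everywhere : ∀ {n p} {P : Pred (Fin n) 0ℓ} → p ≤ n → (∀ a → P a) → Pick p P
pick-everywhere {P = P} p≤n all∈P = pick-fewer {P = P} p≤n ((λ a → a) , (λ eq → eq) , all∈P)

pick-∁-of-few : ∀ {n h} {P : Pred (Fin n) 0ℓ} (P? : Decidable P) →
  2 * h < n → ¬ (suc h ≤ count P?) → Pick (suc h) (∁ P)
pick-∁-of-few {n} {h} P? 2h<n few with suc h ≤? count (∁? P?)
... | yes many = pick (∁? P?) many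
... | no few-∁ = ⊥-elim (<⇒≱ 2h<n n≤2h)
  where
    n≤2h : n ≤ 2 * h
    n≤2h = subst (_≤ 2 * h) (count+count-∁ P?)
      (subst (count P? + count (∁? P?) ≤_) (cong (h +_) (sym (+-identityʳ h)))
        (+-mono-≤ (≤-pred (≰⇒> few)) (≤-pred (≰⇒> few-∁))))

injective-into-interval⇒≤ : ∀ {p lo w} (f : Fin p → ℕ) → Injective _≡_ _≡_ f →
  (∀ a → lo ≤ f a × f a < lo + w) → p ≤ w
injective-into-interval⇒≤ {p} {lo} {w} f f-inj f∈I = injective⇒≤ {f = g} g-inj
  where
    below : ∀ a → f a ∸ lo < w
    below a = subst (f a ∸ lo <_) (m+n∸m≡n lo w) (∸-monoˡ-< (proj₂ (f∈I a)) (proj₁ (f∈I a)))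
    g : Fin p → Fin w
    g a = fromℕ< (below a)
    g-inj : Injective _≡_ _≡_ g
    g-inj {a} {b} eq = f-inj (begin
      f a            ≡⟨ sym (m∸n+n≡m (proj₁ (f∈I a))) ⟩
      f a ∸ lo + lo  ≡⟨ cong (_+ lo) shifted ⟩
      f b ∸ lo + lo  ≡⟨ m∸n+n≡m (proj₁ (f∈I b)) ⟩
      f b            ∎)
      where
        open ≡-Reasoning
        shifted : f a ∸ lo ≡ f b ∸ lo
        shifted = trans (sym (toℕ-fromℕ< (below a))) (trans (cong toℕ eq) (toℕ-fromℕ< (below b)))

_≟ᵛ_ : ∀ {k n} → (u v : Vertex k n) → Dec (u ≡ v)
_≟ᵛ_ = ≡-dec _≟ᶠ_ _≟ᶠ_

incident? : ∀ {k n} (G : ColouredMultigraph k n) e u → Dec (Σ (Vertex k n) λ v → EdgeJoins G e u v)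
incident? G e u with proj₁ (ends G e) ≟ᵛ u | proj₂ (ends G e) ≟ᵛ u
... | yes refl | _        = yes (_ , inj₁ refl)
... | no _     | yes refl = yes (_ , inj₂ refl)
... | no u≢fst | no u≢snd = no λ { (_ , inj₁ eq) → u≢fst (cong proj₁ eq) ; (_ , inj₂ eq) → u≢snd (cong proj₂ eq) }

inW? : ∀ {k n} (G : ColouredMultigraph k n) c u → Dec (InW G c u)
inW? G c u = any? λ e → (colour G e ≟ᶠ c) ×-dec incident? G e u

monoCopy : ∀ {k n p} {G : ColouredMultigraph k n} → ShufflePreserved G → (c : Colour) →
  (∀ i → Pick p (λ a → InW G c (i , a))) → HasMonoCopy p G
monoCopy shuffle c picks =
  (λ i → proj₁ (picks i)) , (λ i → proj₁ (proj₂ (picks i))) , c ,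
  λ i j a b i≢j → shuffle c _ _ (proj₂ (proj₂ (picks i)) a) (proj₂ (proj₂ (picks j)) b) i≢j

colour≢0⇒≡1 : (c : Colour) → c ≢ fzero → c ≡ fsuc fzero
colour≢0⇒≡1 fzero        c≢0 = ⊥-elim (c≢0 refl)
colour≢0⇒≡1 (fsuc fzero) _   = refl

edge-at-∉W₀ : ∀ {k n} (G : ColouredMultigraph k n) e {u v} →
  ¬ InW G fzero u → EdgeJoins G e u v → colour G e ≡ fsuc fzero
edge-at-∉W₀ G e u∉W₀ joins = colour≢0⇒≡1 (colour G e) λ c≡0 → u∉W₀ (e , c≡0 , _ , joins)

other : ∀ {k} → Fin (suc (suc k)) → Fin (suc (suc k))
other fzero    = fsuc fzero
other (fsuc _) = fzero

other-≢ : ∀ {k} (i : Fin (suc (suc k))) → i ≢ other i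
other-≢ fzero    ()
other-≢ (fsuc _) ()

module _ {k n} {G : ColouredMultigraph (suc (suc k)) n} (complete : IsCompleteMultipartite G) where

  ∉W₀⇒∈W₁ : ∀ u → ¬ InW G fzero u → InW G (fsuc fzero) u
  ∉W₀⇒∈W₁ (i , a) u∉W₀ with proj₂ complete (i , a) (other i , a) (other-≢ i)
  ... | e , joins = e , edge-at-∉W₀ G e u∉W₀ joins , _ , joins

  ∉W₀⇒neighbours∈W₁ : ∀ u v → ¬ InW G fzero u → part u ≢ part v → InW G (fsuc fzero) v
  ∉W₀⇒neighbours∈W₁ u v u∉W₀ u≢v with proj₂ complete u v u≢v
  ... | e , joins = e , edge-at-∉W₀ G e u∉W₀ joins , u , swap joins

  module _ (shuffle : ShufflePreserved G) {h} (2h<n : 2 * h < n) where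

    W₀? : ∀ i → Decidable (λ a → InW G fzero (i , a))
    W₀? i a = inW? G fzero (i , a)

    monoCopy-via-W₁ : ∀ i₀ → ¬ (suc h ≤ count (W₀? i₀)) → HasMonoCopy (suc h) G
    monoCopy-via-W₁ i₀ few = monoCopy shuffle (fsuc fzero) picks
      where
        outside : Pick (suc h) (∁ (λ a → InW G fzero (i₀ , a)))
        outside = pick-∁-of-few (W₀? i₀) 2h<n few
        p≤n : suc h ≤ n
        p≤n = ≤-trans (s≤s (m≤m+n h (h + 0))) 2h<n
        picks : ∀ i → Pick (suc h) (λ a → InW G (fsuc fzero) (i , a))
        picks i with i ≟ᶠ i₀
        ... | yes refl = pick-map (λ {a} → ∉W₀⇒∈W₁ (i₀ , a)) outside
        ... | no i≢i₀  = pick-everywhere p≤n λ b →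
          ∉W₀⇒neighbours∈W₁ (i₀ , _) (i , b) (proj₂ (proj₂ outside) fzero) (i≢i₀ ∘ sym)

    monoCopy-if-2h<n : HasMonoCopy (suc h) G
    monoCopy-if-2h<n with all? (λ i → suc h ≤? count (W₀? i))
    ... | yes many = monoCopy shuffle fzero λ i → pick (W₀? i) (many i)
    ... | no not-all with ¬∀⟶∃¬ _ _ (λ i → suc h ≤? count (W₀? i)) not-all
    ...   | i₀ , few = monoCopy-via-W₁ i₀ few

module Palette {k n} (Allowed : Colour → Pred (Vertex k n) 0ℓ) (allowed? : ∀ c → Decidable (Allowed c)) where

  Admissible : Pred (Colour × Vertex k n × Vertex k n) 0ℓ
  Admissible (c , u , v) = Allowed c u × Allowed c v × part u ≢ part v

  admissible? : Decidable Admissible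
  admissible? (c , u , v) = allowed? c u ×-dec allowed? c v ×-dec ¬? (part u ≟ᶠ part v)

  vertices : List (Vertex k n)
  vertices = cartesianProduct (allFin k) (allFin n)

  triples : List (Colour × Vertex k n × Vertex k n)
  triples = cartesianProduct (allFin 2) (cartesianProduct vertices vertices)

  edges : List (Colour × Vertex k n × Vertex k n)
  edges = filter admissible? triples

  graph : ColouredMultigraph k n
  graph = record { m = length edges ; ends = proj₂ ∘ lookup edges ; colour = proj₁ ∘ lookup edges }

  edge-admissible : ∀ e → Admissible (lookup edges e)
  edge-admissible e = proj₂ (∈-filter⁻ admissible? {xs = triples} (∈-lookup {xs = edges} e))

  ∈-vertices : ∀ w → w ∈ vertices
  ∈-vertices (i , a) = ∈-cartesianProduct⁺ (∈-allFin i) (∈-allFin a)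

  joined : ∀ {c u v} → Allowed c u → Allowed c v → part u ≢ part v → JoinedBy graph c u v
  joined {c} {u} {v} u∈c v∈c u≢v = index ∈edges , cong proj₁ (sym lookup≡) , inj₁ (cong proj₂ (sym lookup≡))
    where
      ∈edges : (c , u , v) ∈ edges
      ∈edges = ∈-filter⁺ admissible? (∈-cartesianProduct⁺ (∈-allFin c)
                 (∈-cartesianProduct⁺ (∈-vertices u) (∈-vertices v))) (u∈c , v∈c , u≢v)
      lookup≡ : (c , u , v) ≡ lookup edges (index ∈edges)
      lookup≡ = lookup-index ∈edges

  inW⇒allowed : ∀ {c u} → InW graph c u → Allowed c u
  inW⇒allowed (e , refl , v , inj₁ refl) = proj₁ (edge-admissible e)
  inW⇒allowed (e , refl , v , inj₂ refl) = proj₁ (proj₂ (edge-admissible e))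

  shufflePreserved : ShufflePreserved graph
  shufflePreserved c u v u∈W v∈W = joined (inW⇒allowed u∈W) (inW⇒allowed v∈W)

  complete : (∀ u v → part u ≢ part v → Σ Colour λ c → Allowed c u × Allowed c v) →
    IsCompleteMultipartite graph
  complete common = (λ e → proj₂ (proj₂ (edge-admissible e))) , λ u v u≢v →
    let (c , u∈c , v∈c) = common u v u≢v
        (e , _ , joins) = joined u∈c v∈c u≢v
    in e , joins

module Counterexample {k n h : ℕ} (n≤2h : n ≤ 2 * h) where

  firstPartColour : Fin n → Colour
  firstPartColour a with toℕ a <? h
  ... | yes _ = fzero
  ... | no _  = fsuc fzero

  offset : Colour → ℕ
  offset fzero    = 0
  offset (fsuc _) = h

  firstPartColour-interval : ∀ a c → firstPartColour a ≡ c → offset c ≤ toℕ a × toℕ a < offset c + h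
  firstPartColour-interval a c _ with toℕ a <? h
  firstPartColour-interval a fzero        refl | yes a<h = z≤n , a<h
  firstPartColour-interval a (fsuc fzero) refl | no a≮h  =
    ≮⇒≥ a≮h , subst (λ x → toℕ a < h + x) (+-identityʳ h) (≤-trans (toℕ<n a) n≤2h)

  Allowed : Colour → Pred (Vertex (suc (suc k)) n) 0ℓ
  Allowed c (fzero  , a) = firstPartColour a ≡ c
  Allowed c (fsuc _ , _) = ⊤

  allowed? : ∀ c → Decidable (Allowed c)
  allowed? c (fzero  , a) = firstPartColour a ≟ᶠ c
  allowed? c (fsuc _ , _) = yes tt

  common : ∀ u v → part u ≢ part v → Σ Colour λ c → Allowed c u × Allowed c v
  common (fzero  , a) (fzero  , b) 0≢0 = ⊥-elim (0≢0 refl)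
  common (fzero  , a) (fsuc _ , _) _   = firstPartColour a , refl , tt
  common (fsuc _ , _) (fzero  , b) _   = firstPartColour b , tt , refl
  common (fsuc _ , _) (fsuc _ , _) _   = fzero , tt , tt

  open Palette Allowed allowed? public using (graph; complete; shufflePreserved; inW⇒allowed)

  noMonoCopy : ¬ HasMonoCopy (suc h) graph
  noMonoCopy (A , A-inj , c , A-joined) =
    1+n≰n (injective-into-interval⇒≤ (toℕ ∘ A fzero) (A-inj fzero ∘ toℕ-injective) inInterval)
    where
      inInterval : ∀ a → offset c ≤ toℕ (A fzero a) × toℕ (A fzero a) < offset c + h
      inInterval a =
        let (e , e∈c , joins) = A-joined fzero (fsuc fzero) a a (λ ())
        in firstPartColour-interval (A fzero a) c (inW⇒allowed (e , e∈c , _ , joins))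

theorem4 : (k n p : ℕ) → 2 ≤ k → 1 ≤ n → 1 ≤ p →
    (((G : ColouredMultigraph k n) → IsCompleteMultipartite G → ShufflePreserved G → HasMonoCopy p G)
      → 2 * (p ∸ 1) < n)
    × (2 * (p ∸ 1) < n
      → (G : ColouredMultigraph k n) → IsCompleteMultipartite G → ShufflePreserved G → HasMonoCopy p G)
theorem4 zero          _ _       () _ _
theorem4 (suc zero)    _ _       (s≤s ()) _ _
theorem4 (suc (suc k)) _ zero    _ _ ()
theorem4 (suc (suc k)) n (suc h) _ _ _ = necessary , sufficient
  where
    sufficient : 2 * h < n → (G : ColouredMultigraph (suc (suc k)) n) →
      IsCompleteMultipartite G → ShufflePreserved G → HasMonoCopy (suc h) G
    sufficient 2h<n G complete shuffle = monoCopy-if-2h<n complete shuffle 2h<n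

    necessary : ((G : ColouredMultigraph (suc (suc k)) n) →
      IsCompleteMultipartite G → ShufflePreserved G → HasMonoCopy (suc h) G) → 2 * h < n
    necessary always with 2 * h <? n
    ... | yes 2h<n = 2h<n
    ... | no 2h≮n  = ⊥-elim (noMonoCopy (always graph (complete common) shufflePreserved))
      where open Counterexample {k} {n} {h} (≮⇒≥ 2h≮n)
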